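{- Let $n \ge r \ge 3$. For each paving matroid $M$ of rank $r$ on ground set $[n]$, \[ |\partial \mathcal{V}^0(M)| + \frac{r-1}{2}\,|\partial\mathcal{V}^1(M)| \le \binom{n}{r-1}. \]
   Context: A matroid of rank $r$ is paving if every set of fewer than $r$ elements is independent. The ground set $[n]=\{1,\dots,n\}$ carries its natural linear order. For a hyperplane $H=\{h_1<h_2<\dots<h_m\}$ of $M$ (so $m\ge r-1$), let $V_H^i=\{h_{i+1},\dots,h_{i+r}\}$ for $0\le i\le m-r$ (the consecutive $r$-subsets of $H$; there are none if $m=r-1$). Let $\mathcal{V}^0(H)=\{V_H^i : i \text{ even}\}$, $\mathcal{V}^1(H)=\{V_H^i: i\text{ odd}\}$, and $\mathcal{V}^j(M)=\bigcup_{H}\mathcal{V}^j(H)$ over all hyperplanes $H$ of $M$, $j\in\{0,1\}$. For a collection $\mathcal{X}$ of subsets of $[n]$, $\partial\mathcal{X}=\{Y\subseteq[n] : |Y|=r-1,\ Y\subseteq X\text{ for some }X\in\mathcal{X}\}$ is its $(r-1)$-shadow. -}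

module Defs where

open import Data.Nat using (ℕ; zero; suc; _+_; _∸_; _≤_; _<_; _≤ᵇ_; _≡ᵇ_)
open import Data.Nat.DivMod using (_%_)
open import Data.Bool using (Bool; true; false; _∧_; _∨_; not; T)
open import Data.Fin using (Fin)
open import Data.Fin.Subset using (Subset; inside; outside; _∈_; _∉_; _⊆_; _∪_; ⁅_⁆; ⊥; ∣_∣)
open import Data.Fin.Subset.Properties using (_∈?_; _⊆?_)
open import Data.List using (List; []; _∷_; filter; length; take; drop; upTo; allFin; map)
open import Data.Vec using (Vec; []; _∷_)
open import Relation.Nullary.Decidable using (⌊_⌋)
open import Relation.Unary using (Decidable)
open import Data.Product using (∃; _×_)
open import Data.Bool.ListAction using (any; all)
open import Relation.Binary.PropositionalEquality using (_≡_)

allSubsets : (n : ℕ) → List (Subset n)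
allSubsets zero = [] ∷ []
allSubsets (suc n) = map (outside ∷_) (allSubsets n) Data.List.++ map (inside ∷_) (allSubsets n)

record Matroid (n : ℕ) : Set₁ where
  field
    Indep   : Subset n → Set
    indep?  : Decidable Indep
    indep-∅ : Indep ⊥
    indep-⊆ : ∀ {X Y} → Y ⊆ X → Indep X → Indep Y
    indep-aug : ∀ {X Y} → Indep X → Indep Y → ∣ X ∣ < ∣ Y ∣ →
                ∃ λ y → y ∈ Y × y ∉ X × Indep (X ∪ ⁅ y ⁆)

module _ {n : ℕ} (M : Matroid n) where
  open Matroid M

  indepᵇ : Subset n → Bool
  indepᵇ X = ⌊ indep? X ⌋

  memᵇ : Fin n → Subset n → Bool
  memᵇ e X = ⌊ e ∈? X ⌋

  subᵇ : Subset n → Subset n → Bool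
  subᵇ X Y = ⌊ X ⊆? Y ⌋

  isBasis : Subset n → Bool
  isBasis B = indepᵇ B ∧ all (λ e → memᵇ e B ∨ not (indepᵇ (B ∪ ⁅ e ⁆))) (allFin n)

  isSpanning : Subset n → Bool
  isSpanning X = any (λ B → isBasis B ∧ subᵇ B X) (allSubsets n)

  isHyperplane : Subset n → Bool
  isHyperplane H = not (isSpanning H) ∧ all (λ e → memᵇ e H ∨ isSpanning (H ∪ ⁅ e ⁆)) (allFin n)

HasRank : {n : ℕ} → Matroid n → ℕ → Set
HasRank {n} M r = (∃ λ X → Matroid.Indep M X × ∣ X ∣ ≡ r)
                  × (∀ X → Matroid.Indep M X → ∣ X ∣ ≤ r)

IsPaving : {n : ℕ} → Matroid n → ℕ → Set
IsPaving {n} M r = HasRank M r × (∀ X → ∣ X ∣ < r → Matroid.Indep M X)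

-- Elements of a subset, listed in increasing order (h₁ < h₂ < … < hₘ).
elems : {n : ℕ} → Subset n → List (Fin n)
elems {n} H = filter (_∈? H) (allFin n)

fromList : {n : ℕ} → List (Fin n) → Subset n
fromList [] = ⊥
fromList (x ∷ xs) = ⁅ x ⁆ ∪ fromList xs

-- V_H^i = {h_{i+1}, …, h_{i+r}} (meaningful for i + r ≤ m = |H|).
window : {n : ℕ} → ℕ → Subset n → ℕ → Subset n
window r H i = fromList (take r (drop i (elems H)))

windowIndices : {n : ℕ} → ℕ → Subset n → ℕ → List ℕ
windowIndices r H j =
  Data.List.filterᵇ (λ i → (i + r ≤ᵇ ∣ H ∣) ∧ (i % 2 ≡ᵇ j)) (upTo (suc ∣ H ∣))

-- Y ∈ ∂ 𝒱ʲ(M): |Y| = r − 1 and Y ⊆ V_H^i for some hyperplane H and some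
-- admissible i of parity j.
inShadowᵇ : {n : ℕ} → Matroid n → ℕ → ℕ → Subset n → Bool
inShadowᵇ {n} M r j Y =
  (∣ Y ∣ ≡ᵇ (r ∸ 1)) ∧
  any (λ H → isHyperplane M H ∧
             any (λ i → subᵇ M Y (window r H i)) (windowIndices r H j))
      (allSubsets n)

shadowSize : {n : ℕ} → Matroid n → ℕ → ℕ → ℕ
shadowSize {n} M r j = length (Data.List.filterᵇ (inShadowᵇ M r j) (allSubsets n))

-- In a paving matroid of rank r every (r − 1)-set is independent, so it lies in at most one
-- hyperplane: distinct hyperplanes share no (r − 1)-subset, and
-- Σ_H C(|H|, r − 1) ≤ C(n, r − 1). A window has at most r elements, hence at most r subsets
-- of size r − 1, so a hyperplane with r + t elements, e even and o odd windows
-- (e + o = t + 1, e ≥ 1) contributes at most r·e to |∂𝒱⁰| and r·o to |∂𝒱¹|. As r − 1 ≥ 2,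
-- 2re + (r − 1)ro ≤ r(2 + (r − 1)t) ≤ 2·C(r + t, r − 1), the last step by induction on t
-- with Pascal's rule.

module Submission where

open import Defs
open import Data.Nat
  using (ℕ; zero; suc; _+_; _*_; _∸_; _⊓_; _≤_; _<_; _≤ᵇ_; _≡ᵇ_; _≤?_; _≤′_; ≤′-refl; ≤′-step; z≤n; s≤s)
open import Data.Nat.Properties
open import Data.Nat.DivMod using (_%_)
open import Data.Nat.Combinatorics using (_C_; nCk+nC[k+1]≡[n+1]C[k+1]; nCk≡nC[n∸k]; nC1≡n)
open import Data.Nat.Tactic.RingSolver using (solve)
open import Data.Bool using (Bool; true; false; _∧_; _∨_; not; T)
open import Data.Bool.Properties using (T-∧; T-∨; ∧-zeroʳ; ∧-identityʳ)
open import Data.Bool.ListAction using (any)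
open import Data.List using (List; []; _∷_; _++_; map; length; filterᵇ; take; drop; applyUpTo; upTo; allFin)
open import Data.List.Properties using (length-take)
open import Data.List.Relation.Unary.Any using (here; satisfied)
open import Data.List.Relation.Unary.Any.Properties using (any⁺; any⁻)
import Data.List.Relation.Unary.All as All
open import Data.List.Relation.Unary.All.Properties using (all⁺; all⁻)
open import Data.List.Membership.Propositional using (lose) renaming (_∈_ to _∈ₗ_)
open import Data.List.Membership.Propositional.Properties using (∈-allFin; ∈-map⁺; ∈-++⁺ˡ; ∈-++⁺ʳ)
open import Data.Vec using (_∷_; [])
open import Data.Vec.Properties using (∷-injectiveˡ; ∷-injectiveʳ)
open import Data.Fin using (Fin)
open import Data.Fin.Subset using (Subset; Side; inside; outside; _∈_; _∉_; _⊆_; _∪_; ⁅_⁆; ⊤; ∣_∣)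
open import Data.Fin.Subset.Properties
  using ( _∈?_; _⊆?_; ∣p∣≤∣x∷p∣; ∣⊥∣≡0; ∣⊤∣≡n; ∣⁅x⁆∣≡1; ⊆⊤; ⊆-antisym; p⊂q⇒∣p∣<∣q∣
        ; p⊆p∪q; q⊆p∪q; x∈p∪q⁻; x∈⁅x⁆; x∈⁅y⁆⇒x≡y)
open import Data.Product using (∃; _×_; _,_; proj₁; proj₂)
open import Data.Sum using (_⊎_; inj₁; inj₂; [_,_]) renaming (map to ⊎-map)
open import Data.Empty using (⊥; ⊥-elim)
open import Algebra.Properties.CommutativeSemigroup +-commutativeSemigroup
  using () renaming (interchange to +-interchange)
open import Function using (_∘_; _∘₂_; _∋_; Equivalence)
open import Relation.Binary.PropositionalEquality
  using (_≡_; _≢_; refl; sym; trans; cong; cong₂; subst; module ≡-Reasoning)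
open import Relation.Nullary using (¬_; yes; no)
open import Relation.Nullary.Decidable
  using ( ⌊_⌋; toWitness; fromWitness; toWitnessFalse; fromWitnessFalse
        ; isYes≗does; dec-true; dec-false; ⌊⌋-map′)

private
  variable
    A B : Set

∑ : List A → (A → ℕ) → ℕ
∑ []       f = 0
∑ (x ∷ xs) f = f x + ∑ xs f

syntax ∑ xs (λ x → e) = ∑[ x ← xs ] e

∑-cong : ∀ (xs : List A) {f g : A → ℕ} → (∀ x → f x ≡ g x) → ∑ xs f ≡ ∑ xs g
∑-cong []       f≗g = refl
∑-cong (x ∷ xs) f≗g = cong₂ _+_ (f≗g x) (∑-cong xs f≗g)

∑-mono : ∀ (xs : List A) {f g : A → ℕ} → (∀ x → f x ≤ g x) → ∑ xs f ≤ ∑ xs g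
∑-mono []       f≤g = z≤n
∑-mono (x ∷ xs) f≤g = +-mono-≤ (f≤g x) (∑-mono xs f≤g)

∑-const : ∀ (xs : List A) k → ∑[ _ ← xs ] k ≡ k * length xs
∑-const []       k = sym (*-zeroʳ k)
∑-const (x ∷ xs) k = trans (cong (k +_) (∑-const xs k)) (sym (*-suc k (length xs)))

∑-zero : ∀ (xs : List A) {f : A → ℕ} → (∀ x → f x ≡ 0) → ∑ xs f ≡ 0
∑-zero xs f≗0 = trans (∑-cong xs f≗0) (∑-const xs 0)

∑-++ : ∀ (xs ys : List A) (f : A → ℕ) → ∑ (xs ++ ys) f ≡ ∑ xs f + ∑ ys f
∑-++ []       ys f = refl
∑-++ (x ∷ xs) ys f = trans (cong (f x +_) (∑-++ xs ys f)) (sym (+-assoc (f x) _ _))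

∑-map : ∀ (g : A → B) (xs : List A) (f : B → ℕ) → ∑ (map g xs) f ≡ ∑ xs (f ∘ g)
∑-map g []       f = refl
∑-map g (x ∷ xs) f = cong (f (g x) +_) (∑-map g xs f)

∑-+ : ∀ (xs : List A) (f g : A → ℕ) → ∑[ x ← xs ] (f x + g x) ≡ ∑ xs f + ∑ xs g
∑-+ []       f g = refl
∑-+ (x ∷ xs) f g = begin
  f x + g x + ∑[ x ← xs ] (f x + g x) ≡⟨ cong (f x + g x +_) (∑-+ xs f g) ⟩
  f x + g x + (∑ xs f + ∑ xs g)       ≡⟨ +-interchange (f x) (g x) _ _ ⟩
  f x + ∑ xs f + (g x + ∑ xs g)       ∎
  where open ≡-Reasoning

∑-*ˡ : ∀ (xs : List A) k (f : A → ℕ) → ∑[ x ← xs ] (k * f x) ≡ k * ∑ xs f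
∑-*ˡ []       k f = sym (*-zeroʳ k)
∑-*ˡ (x ∷ xs) k f = trans (cong (k * f x +_) (∑-*ˡ xs k f)) (sym (*-distribˡ-+ k (f x) _))

∑-linear : ∀ (xs : List A) a b (f g : A → ℕ) → ∑[ x ← xs ] (a * f x + b * g x) ≡ a * ∑ xs f + b * ∑ xs g
∑-linear xs a b f g = trans (∑-+ xs _ _) (cong₂ _+_ (∑-*ˡ xs a f) (∑-*ˡ xs b g))

∑-comm : ∀ (xs : List A) (ys : List B) (f : A → B → ℕ) →
         ∑[ x ← xs ] ∑[ y ← ys ] f x y ≡ ∑[ y ← ys ] ∑[ x ← xs ] f x y
∑-comm []       ys f = sym (∑-zero ys (λ _ → refl))
∑-comm (x ∷ xs) ys f = trans (cong (∑ ys (f x) +_) (∑-comm xs ys f)) (sym (∑-+ ys (f x) _))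

ind : Bool → ℕ
ind true  = 1
ind false = 0

count : (A → Bool) → List A → ℕ
count p xs = ∑[ x ← xs ] ind (p x)

ind≤1 : ∀ b → ind b ≤ 1
ind≤1 true  = s≤s z≤n
ind≤1 false = z≤n

ind-∧ : ∀ a b → ind (a ∧ b) ≡ ind a * ind b
ind-∧ true  b = sym (+-identityʳ (ind b))
ind-∧ false b = refl

ind-∧-∧ : ∀ a b c → ind (a ∧ (b ∧ c)) ≡ ind b * ind (a ∧ c)
ind-∧-∧ false b     c = sym (*-zeroʳ (ind b))
ind-∧-∧ true  false c = refl
ind-∧-∧ true  true  c = sym (+-identityʳ (ind c))

length-filterᵇ : ∀ (p : A → Bool) xs → length (filterᵇ p xs) ≡ count p xs
length-filterᵇ p []       = refl
length-filterᵇ p (x ∷ xs) with p x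
... | true  = cong suc (length-filterᵇ p xs)
... | false = length-filterᵇ p xs

ind-any≤count : ∀ (p : A → Bool) xs → ind (any p xs) ≤ count p xs
ind-any≤count p []       = z≤n
ind-any≤count p (x ∷ xs) with p x
... | true  = s≤s z≤n
... | false = ind-any≤count p xs

ind-∧-any≤count : ∀ a (p : A → Bool) xs → ind (a ∧ any p xs) ≤ count (λ x → a ∧ p x) xs
ind-∧-any≤count true  p xs = ind-any≤count p xs
ind-∧-any≤count false p xs = z≤n

0<count⇒∃ : ∀ (p : A → Bool) xs → 0 < count p xs → ∃ λ x → T (p x)
0<count⇒∃ p (x ∷ xs) pos with p x in px
... | true  = x , subst T (sym px) _
... | false = 0<count⇒∃ p xs pos

-- Subsets of [n] and binomial coefficients

∑-allSubsets : ∀ {n} (f : Subset (suc n) → ℕ) →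
  ∑ (allSubsets (suc n)) f ≡ ∑[ X ← allSubsets n ] f (outside ∷ X) + ∑[ X ← allSubsets n ] f (inside ∷ X)
∑-allSubsets {n} f = begin
  ∑ (map (outside ∷_) (allSubsets n) ++ map (inside ∷_) (allSubsets n)) f
    ≡⟨ ∑-++ (map (outside ∷_) (allSubsets n)) _ f ⟩
  ∑ (map (outside ∷_) (allSubsets n)) f + ∑ (map (inside ∷_) (allSubsets n)) f
    ≡⟨ cong₂ _+_ (∑-map (outside ∷_) (allSubsets n) f) (∑-map (inside ∷_) (allSubsets n) f) ⟩
  ∑[ X ← allSubsets n ] f (outside ∷ X) + ∑[ X ← allSubsets n ] f (inside ∷ X) ∎
  where open ≡-Reasoning

∈-allSubsets : ∀ {n} (X : Subset n) → X ∈ₗ allSubsets n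
∈-allSubsets []            = here refl
∈-allSubsets (outside ∷ X) = ∈-++⁺ˡ (∈-map⁺ (outside ∷_) (∈-allSubsets X))
∈-allSubsets (inside ∷ X)  = ∈-++⁺ʳ (map (outside ∷_) (allSubsets _)) (∈-map⁺ (inside ∷_) (∈-allSubsets X))

count-allSubsets≤1 : ∀ {n} (p : Subset n → Bool) → (∀ {X Y} → T (p X) → T (p Y) → X ≡ Y) →
                     count p (allSubsets n) ≤ 1
count-allSubsets≤1 {zero}  p unique = ≤-trans (≤-reflexive (+-identityʳ _)) (ind≤1 (p []))
count-allSubsets≤1 {suc n} p unique rewrite ∑-allSubsets (ind ∘ p) =
  sum≤1 (count-allSubsets≤1 (p ∘ (outside ∷_)) (∷-injectiveʳ ∘₂ unique))
        (count-allSubsets≤1 (p ∘ (inside ∷_)) (∷-injectiveʳ ∘₂ unique))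
        (λ pos₀ pos₁ → let X , pX = 0<count⇒∃ _ (allSubsets n) pos₀
                           Y , pY = 0<count⇒∃ _ (allSubsets n) pos₁
                       in outside≢inside (∷-injectiveˡ (unique pX pY)))
  where
  outside≢inside : outside ≢ inside
  outside≢inside ()
  sum≤1 : ∀ {a b} → a ≤ 1 → b ≤ 1 → (0 < a → 0 < b → ⊥) → a + b ≤ 1
  sum≤1 {zero} _ b≤1 _ = b≤1
  sum≤1 {suc zero} {zero} a≤1 _ _ = a≤1
  sum≤1 {suc zero} {suc b} _ _ both = ⊥-elim (both (s≤s z≤n) (s≤s z≤n))
  sum≤1 {suc (suc a)} (s≤s ())

[n+1]C[k+1] : ∀ n k → suc n C suc k ≡ n C suc k + n C k
[n+1]C[k+1] n k = trans (sym (nCk+nC[k+1]≡[n+1]C[k+1] n k)) (+-comm (n C k) _)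

C≤[n+1]C : ∀ n k → n C k ≤ suc n C k
C≤[n+1]C n zero    = ≤-refl
C≤[n+1]C n (suc k) = subst (n C suc k ≤_) (sym ([n+1]C[k+1] n k)) (m≤m+n _ _)

C-monoˡ-≤ : ∀ {m n} k → m ≤ n → m C k ≤ n C k
C-monoˡ-≤ k m≤n = go (≤⇒≤′ m≤n)
  where
  go : ∀ {m n} → m ≤′ n → m C k ≤ n C k
  go ≤′-refl        = ≤-refl
  go (≤′-step m≤′n) = ≤-trans (go m≤′n) (C≤[n+1]C _ k)

[n+1]Cn≡n+1 : ∀ n → suc n C n ≡ suc n
[n+1]Cn≡n+1 n = begin
  suc n C n           ≡⟨ nCk≡nC[n∸k] (n≤1+n n) ⟩
  suc n C (suc n ∸ n) ≡⟨ cong (suc n C_) (m+n∸n≡m 1 n) ⟩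
  suc n C 1           ≡⟨ nC1≡n (suc n) ⟩
  suc n               ∎
  where open ≡-Reasoning

2*[n+2]Cn≡[n+2]*[n+1] : ∀ n → 2 * ((2 + n) C n) ≡ (2 + n) * (1 + n)
2*[n+2]Cn≡[n+2]*[n+1] zero    = refl
2*[n+2]Cn≡[n+2]*[n+1] (suc n) = begin
  2 * ((3 + n) C suc n)               ≡⟨ cong (2 *_) ([n+1]C[k+1] (2 + n) n) ⟩
  2 * ((2 + n) C suc n + (2 + n) C n) ≡⟨ cong (λ c → 2 * (c + (2 + n) C n)) ([n+1]Cn≡n+1 (suc n)) ⟩
  2 * (2 + n + (2 + n) C n)           ≡⟨ *-distribˡ-+ 2 (2 + n) _ ⟩
  2 * (2 + n) + 2 * ((2 + n) C n)     ≡⟨ cong (2 * (2 + n) +_) (2*[n+2]Cn≡[n+2]*[n+1] n) ⟩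
  2 * (2 + n) + (2 + n) * (1 + n)     ≡⟨ solve (List ℕ ∋ n ∷ []) ⟩
  (3 + n) * (2 + n)                   ∎
  where open ≡-Reasoning

∣p∪q∣≤∣p∣+∣q∣ : ∀ {n} (p q : Subset n) → ∣ p ∪ q ∣ ≤ ∣ p ∣ + ∣ q ∣
∣p∪q∣≤∣p∣+∣q∣ []            []            = z≤n
∣p∪q∣≤∣p∣+∣q∣ (outside ∷ p) (outside ∷ q) = ∣p∪q∣≤∣p∣+∣q∣ p q
∣p∪q∣≤∣p∣+∣q∣ (outside ∷ p) (inside ∷ q)  =
  subst (suc ∣ p ∪ q ∣ ≤_) (sym (+-suc ∣ p ∣ ∣ q ∣)) (s≤s (∣p∪q∣≤∣p∣+∣q∣ p q))
∣p∪q∣≤∣p∣+∣q∣ (inside ∷ p)  (s ∷ q)       =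
  s≤s (≤-trans (∣p∪q∣≤∣p∣+∣q∣ p q) (+-monoʳ-≤ ∣ p ∣ (∣p∣≤∣x∷p∣ s q)))

∣fromList∣≤length : ∀ {n} (xs : List (Fin n)) → ∣ fromList xs ∣ ≤ length xs
∣fromList∣≤length {n} []       = ≤-reflexive (∣⊥∣≡0 n)
∣fromList∣≤length     (x ∷ xs) = begin
  ∣ ⁅ x ⁆ ∪ fromList xs ∣         ≤⟨ ∣p∪q∣≤∣p∣+∣q∣ ⁅ x ⁆ (fromList xs) ⟩
  ∣ ⁅ x ⁆ ∣ + ∣ fromList xs ∣     ≡⟨ cong (_+ ∣ fromList xs ∣) (∣⁅x⁆∣≡1 x) ⟩
  suc ∣ fromList xs ∣             ≤⟨ s≤s (∣fromList∣≤length xs) ⟩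
  suc (length xs)                 ∎
  where open ≤-Reasoning

∣p∣<∣p∪⁅x⁆∣ : ∀ {n} {p : Subset n} {x} → x ∉ p → ∣ p ∣ < ∣ p ∪ ⁅ x ⁆ ∣
∣p∣<∣p∪⁅x⁆∣ {p = p} {x} x∉p = p⊂q⇒∣p∣<∣q∣ (p⊆p∪q ⁅ x ⁆ , x , q⊆p∪q p ⁅ x ⁆ (x∈⁅x⁆ x) , x∉p)

p∪⁅x⁆⊆q : ∀ {n} {p q : Subset n} {x} → p ⊆ q → x ∈ q → p ∪ ⁅ x ⁆ ⊆ q
p∪⁅x⁆⊆q {p = p} {x = x} p⊆q x∈q y∈ with x∈p∪q⁻ p ⁅ x ⁆ y∈
... | inj₁ y∈p = p⊆q y∈p
... | inj₂ y∈x rewrite x∈⁅y⁆⇒x≡y x y∈x = x∈q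

count-⊆-ofSize : ∀ {n} k (A : Subset n) →
                 count (λ Y → (∣ Y ∣ ≡ᵇ k) ∧ ⌊ Y ⊆? A ⌋) (allSubsets n) ≡ ∣ A ∣ C k
count-⊆-ofSize {zero}  zero    [] = refl
count-⊆-ofSize {zero}  (suc k) [] = refl
count-⊆-ofSize {suc n} k (a ∷ A) = begin
  count (λ Y → (∣ Y ∣ ≡ᵇ k) ∧ ⌊ Y ⊆? a ∷ A ⌋) (allSubsets (suc n))
    ≡⟨ ∑-allSubsets (λ Y → ind ((∣ Y ∣ ≡ᵇ k) ∧ ⌊ Y ⊆? a ∷ A ⌋)) ⟩
  count (λ Y → (∣ Y ∣ ≡ᵇ k) ∧ ⌊ outside ∷ Y ⊆? a ∷ A ⌋) (allSubsets n) + with-inside a k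
    ≡⟨ cong (_+ with-inside a k) (restrict k (λ Y → ⌊⌋-map′ _ _ (Y ⊆? A))) ⟩
  ∣ A ∣ C k + with-inside a k
    ≡⟨ pascal a k ⟩
  ∣ a ∷ A ∣ C k ∎
  where
  open ≡-Reasoning
  with-inside : Side → ℕ → ℕ
  with-inside a k = count (λ Y → (∣ inside ∷ Y ∣ ≡ᵇ k) ∧ ⌊ inside ∷ Y ⊆? a ∷ A ⌋) (allSubsets n)
  restrict : ∀ {s t} k → (∀ Y → ⌊ s ∷ Y ⊆? t ∷ A ⌋ ≡ ⌊ Y ⊆? A ⌋) →
             count (λ Y → (∣ Y ∣ ≡ᵇ k) ∧ ⌊ s ∷ Y ⊆? t ∷ A ⌋) (allSubsets n) ≡ ∣ A ∣ C k
  restrict k drop-head =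
    trans (∑-cong (allSubsets n) λ Y → cong (λ b → ind ((∣ Y ∣ ≡ᵇ k) ∧ b)) (drop-head Y)) (count-⊆-ofSize k A)
  pascal : ∀ a k → ∣ A ∣ C k + with-inside a k ≡ ∣ a ∷ A ∣ C k
  pascal outside k      = trans (cong (∣ A ∣ C k +_) (∑-zero (allSubsets n) λ _ → cong ind (∧-zeroʳ _)))
                                (+-identityʳ _)
  pascal inside zero    = cong (1 +_) (∑-zero (allSubsets n) λ _ → refl)
  pascal inside (suc k) = trans (cong (∣ A ∣ C suc k +_) (restrict k (λ Y → ⌊⌋-map′ _ _ (Y ⊆? A))))
                                (sym ([n+1]C[k+1] ∣ A ∣ k))

count-ofSize : ∀ n k → count (λ Y → ∣ Y ∣ ≡ᵇ k) (allSubsets n) ≡ n C k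
count-ofSize n k = begin
  count (λ Y → ∣ Y ∣ ≡ᵇ k) (allSubsets n)
    ≡⟨ ∑-cong (allSubsets n) (λ Y → cong ind (sym (trans (cong ((∣ Y ∣ ≡ᵇ k) ∧_) (⊆⊤ᵇ Y)) (∧-identityʳ _)))) ⟩
  count (λ Y → (∣ Y ∣ ≡ᵇ k) ∧ ⌊ Y ⊆? ⊤ ⌋) (allSubsets n)
    ≡⟨ count-⊆-ofSize {n} k ⊤ ⟩
  ∣ ⊤ {n} ∣ C k
    ≡⟨ cong (_C k) (∣⊤∣≡n n) ⟩
  n C k ∎
  where
  open ≡-Reasoning
  ⊆⊤ᵇ : ∀ (Y : Subset n) → ⌊ Y ⊆? ⊤ ⌋ ≡ true
  ⊆⊤ᵇ Y = trans (isYes≗does (Y ⊆? ⊤)) (dec-true (Y ⊆? ⊤) ⊆⊤)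

-- Bases, spanning sets and hyperplanes

T-not⇒¬T : ∀ {b} → T (not b) → ¬ T b
T-not⇒¬T {false} _ ()

module _ {n : ℕ} (M : Matroid n) where
  open Matroid M

  Maximal : Subset n → Set
  Maximal B = ∀ e → e ∈ B ⊎ ¬ Indep (B ∪ ⁅ e ⁆)

  private
    extendsᵇ : Subset n → Fin n → Bool
    extendsᵇ B e = memᵇ M e B ∨ not (indepᵇ M (B ∪ ⁅ e ⁆))

  isBasis⇒maximal : ∀ {B} → T (isBasis M B) → Indep B × Maximal B
  isBasis⇒maximal {B} basis =
    let indepB , extends = Equivalence.to (T-∧ {indepᵇ M B}) basis
    in toWitness indepB , λ e →
         ⊎-map toWitness toWitnessFalse
           (Equivalence.to (T-∨ {memᵇ M e B})
             (All.lookup (all⁺ (extendsᵇ B) (allFin n) extends) (∈-allFin e)))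

  maximal⇒isBasis : ∀ {B} → Indep B → Maximal B → T (isBasis M B)
  maximal⇒isBasis {B} indepB maximal =
    Equivalence.from (T-∧ {indepᵇ M B})
      (fromWitness indepB , all⁻ (extendsᵇ B) {allFin n} (All.tabulate λ {e} _ →
        Equivalence.from (T-∨ {memᵇ M e B}) (⊎-map fromWitness fromWitnessFalse (maximal e))))

  isHyperplane⇒ : ∀ {H} → T (isHyperplane M H) →
                  ¬ T (isSpanning M H) × (∀ e → e ∉ H → T (isSpanning M (H ∪ ⁅ e ⁆)))
  isHyperplane⇒ {H} hyperplane =
    let nonspanning , extends = Equivalence.to (T-∧ {not (isSpanning M H)}) hyperplane
    in T-not⇒¬T nonspanning , λ e e∉H →
         [ (λ e∈H → ⊥-elim (e∉H (toWitness e∈H))) , (λ spanning → spanning) ]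
           (Equivalence.to (T-∨ {memᵇ M e H}) (All.lookup
             (all⁺ (λ e → memᵇ M e H ∨ isSpanning M (H ∪ ⁅ e ⁆)) (allFin n) extends) (∈-allFin e)))

  module _ {r : ℕ} (rank : HasRank M r) where

    maximal⇒r≤∣B∣ : ∀ {B} → Indep B → Maximal B → r ≤ ∣ B ∣
    maximal⇒r≤∣B∣ {B} indepB maximal with r ≤? ∣ B ∣ | proj₁ rank
    ... | yes r≤∣B∣ | _ = r≤∣B∣
    ... | no r≰∣B∣  | X , indepX , ∣X∣≡r
      with indep-aug indepB indepX (subst (∣ B ∣ <_) (sym ∣X∣≡r) (≰⇒> r≰∣B∣))
    ... | y , _ , y∉B , indepB∪y = ⊥-elim ([ y∉B , (λ dependent → dependent indepB∪y) ] (maximal y))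

    r≤∣B∣⇒maximal : ∀ {B} → Indep B → r ≤ ∣ B ∣ → Maximal B
    r≤∣B∣⇒maximal {B} indepB r≤∣B∣ e with e ∈? B
    ... | yes e∈B = inj₁ e∈B
    ... | no  e∉B = inj₂ λ indepB∪e →
      <⇒≱ (≤-<-trans r≤∣B∣ (∣p∣<∣p∪⁅x⁆∣ e∉B)) (proj₂ rank _ indepB∪e)

    isSpanning⇒ : ∀ {X} → T (isSpanning M X) → ∃ λ B → Indep B × r ≤ ∣ B ∣ × B ⊆ X
    isSpanning⇒ {X} spanning =
      let B , basis∧B⊆X = satisfied (any⁻ (λ B → isBasis M B ∧ subᵇ M B X) (allSubsets n) spanning)
          basis , B⊆X     = Equivalence.to (T-∧ {isBasis M B}) basis∧B⊆X
          indepB , maximal = isBasis⇒maximal basis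
      in B , indepB , maximal⇒r≤∣B∣ indepB maximal , toWitness B⊆X

    ⇒isSpanning : ∀ {B X} → Indep B → r ≤ ∣ B ∣ → B ⊆ X → T (isSpanning M X)
    ⇒isSpanning {B} {X} indepB r≤∣B∣ B⊆X =
      any⁺ (λ B → isBasis M B ∧ subᵇ M B X) (lose (∈-allSubsets B)
        (Equivalence.from (T-∧ {isBasis M B})
          (maximal⇒isBasis indepB (r≤∣B∣⇒maximal indepB r≤∣B∣) , fromWitness (λ {x} → B⊆X {x}))))

    -- For x ∈ H ∖ H', the set H' ∪ {x} is spanning, so the exchange axiom extends Y by an
    -- element of H' or by x to an r-element independent set inside H' or H.
    hyperplane-⊆ : ∀ {Y H H'} → Indep Y → suc ∣ Y ∣ ≡ r →
                   T (isHyperplane M H) → T (isHyperplane M H') → Y ⊆ H → Y ⊆ H' → H ⊆ H'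
    hyperplane-⊆ {Y} {H} {H'} indepY ∣Y∣+1≡r hypH hypH' Y⊆H Y⊆H' {x} x∈H with x ∈? H'
    ... | yes x∈H' = x∈H'
    ... | no  x∉H' with isSpanning⇒ (proj₂ (isHyperplane⇒ hypH') x x∉H')
    ... | B , indepB , r≤∣B∣ , B⊆H'∪x
      with indep-aug indepY indepB (<-≤-trans (subst (∣ Y ∣ <_) ∣Y∣+1≡r ≤-refl) r≤∣B∣)
    ... | b , b∈B , b∉Y , indepY∪b =
      ⊥-elim ([ spans hypH' Y⊆H' , (λ b∈⁅x⁆ → spans hypH Y⊆H (subst (_∈ H) (sym (x∈⁅y⁆⇒x≡y x b∈⁅x⁆)) x∈H)) ]
              (x∈p∪q⁻ H' ⁅ x ⁆ (B⊆H'∪x b∈B)))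
      where
      spans : ∀ {K} → T (isHyperplane M K) → Y ⊆ K → b ∈ K → ⊥
      spans hypK Y⊆K b∈K = proj₁ (isHyperplane⇒ hypK)
        (⇒isSpanning indepY∪b (subst (_≤ ∣ Y ∪ ⁅ b ⁆ ∣) ∣Y∣+1≡r (∣p∣<∣p∪⁅x⁆∣ b∉Y))
                              (p∪⁅x⁆⊆q Y⊆K b∈K))

    hyperplane-unique : ∀ {Y H H'} → Indep Y → suc ∣ Y ∣ ≡ r →
                        T (isHyperplane M H) → T (isHyperplane M H') → Y ⊆ H → Y ⊆ H' → H ≡ H'
    hyperplane-unique indepY ∣Y∣+1≡r hypH hypH' Y⊆H Y⊆H' =
      ⊆-antisym (hyperplane-⊆ indepY ∣Y∣+1≡r hypH hypH' Y⊆H Y⊆H')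
                (hyperplane-⊆ indepY ∣Y∣+1≡r hypH' hypH Y⊆H' Y⊆H)

-- Windows and shadows

∣window∣≤ : ∀ {n} r (H : Subset n) i → ∣ window r H i ∣ ≤ r
∣window∣≤ r H i = begin
  ∣ fromList (take r (drop i (elems H))) ∣ ≤⟨ ∣fromList∣≤length (take r (drop i (elems H))) ⟩
  length (take r (drop i (elems H)))     ≡⟨ length-take r _ ⟩
  r ⊓ length (drop i (elems H))          ≤⟨ m⊓n≤m r _ ⟩
  r                                      ∎
  where open ≤-Reasoning

count-window-subsets≤ : ∀ {n} r' (H : Subset n) i →
  count (λ Y → (∣ Y ∣ ≡ᵇ r') ∧ ⌊ Y ⊆? window (suc r') H i ⌋) (allSubsets n) ≤ suc r'
count-window-subsets≤ {n} r' H i = begin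
  count (λ Y → (∣ Y ∣ ≡ᵇ r') ∧ ⌊ Y ⊆? window (suc r') H i ⌋) (allSubsets n)
    ≡⟨ count-⊆-ofSize r' (window (suc r') H i) ⟩
  ∣ window (suc r') H i ∣ C r'
    ≤⟨ C-monoˡ-≤ r' (∣window∣≤ (suc r') H i) ⟩
  suc r' C r'
    ≡⟨ [n+1]Cn≡n+1 r' ⟩
  suc r' ∎
  where open ≤-Reasoning

shadowSize≤ : ∀ {n} (M : Matroid n) r' j →
  shadowSize M (suc r') j ≤
    ∑[ H ← allSubsets n ] (ind (isHyperplane M H) * (suc r' * length (windowIndices (suc r') H j)))
shadowSize≤ {n} M r' j = begin
  shadowSize M r j
    ≡⟨ length-filterᵇ (inShadowᵇ M r j) S ⟩
  count (inShadowᵇ M r j) S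
    ≤⟨ ∑-mono S union-bound ⟩
  ∑[ Y ← S ] ∑[ H ← S ] (ind (hyp H) * ∑[ i ← I H ] ind (c Y ∧ s Y H i))
    ≡⟨ ∑-comm S S _ ⟩
  ∑[ H ← S ] ∑[ Y ← S ] (ind (hyp H) * ∑[ i ← I H ] ind (c Y ∧ s Y H i))
    ≡⟨ ∑-cong S (λ H → ∑-*ˡ S (ind (hyp H)) _) ⟩
  ∑[ H ← S ] (ind (hyp H) * ∑[ Y ← S ] ∑[ i ← I H ] ind (c Y ∧ s Y H i))
    ≡⟨ ∑-cong S (λ H → cong (ind (hyp H) *_) (∑-comm S (I H) _)) ⟩
  ∑[ H ← S ] (ind (hyp H) * ∑[ i ← I H ] count (λ Y → c Y ∧ s Y H i) S)
    ≤⟨ ∑-mono S (λ H → *-monoʳ-≤ (ind (hyp H)) (∑-mono (I H) (count-window-subsets≤ r' H))) ⟩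
  ∑[ H ← S ] (ind (hyp H) * ∑[ i ← I H ] r)
    ≡⟨ ∑-cong S (λ H → cong (ind (hyp H) *_) (∑-const (I H) r)) ⟩
  ∑[ H ← S ] (ind (hyp H) * (r * length (I H))) ∎
  where
  open ≤-Reasoning
  r : ℕ
  r = suc r'
  S : List (Subset n)
  S = allSubsets n
  hyp : Subset n → Bool
  hyp = isHyperplane M
  c : Subset n → Bool
  c Y = ∣ Y ∣ ≡ᵇ r'
  I : Subset n → List ℕ
  I H = windowIndices r H j
  s : Subset n → Subset n → ℕ → Bool
  s Y H i = ⌊ Y ⊆? window r H i ⌋
  union-bound : ∀ Y → ind (inShadowᵇ M r j Y) ≤ ∑[ H ← S ] (ind (hyp H) * ∑[ i ← I H ] ind (c Y ∧ s Y H i))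
  union-bound Y = begin
    ind (c Y ∧ any (λ H → hyp H ∧ any (s Y H) (I H)) S)
      ≤⟨ ind-∧-any≤count (c Y) _ S ⟩
    ∑[ H ← S ] ind (c Y ∧ (hyp H ∧ any (s Y H) (I H)))
      ≡⟨ ∑-cong S (λ H → ind-∧-∧ (c Y) (hyp H) _) ⟩
    ∑[ H ← S ] (ind (hyp H) * ind (c Y ∧ any (s Y H) (I H)))
      ≤⟨ ∑-mono S (λ H → *-monoʳ-≤ (ind (hyp H)) (ind-∧-any≤count (c Y) (s Y H) (I H))) ⟩
    ∑[ H ← S ] (ind (hyp H) * ∑[ i ← I H ] ind (c Y ∧ s Y H i)) ∎

-- Counting windows

binomial-lower-bound : ∀ k t → (2 + k) * (2 + (1 + k) * t) ≤ 2 * ((t + (2 + k)) C (1 + k))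
binomial-lower-bound k zero    = ≤-reflexive (begin
  (2 + k) * (2 + (1 + k) * 0) ≡⟨ solve (List ℕ ∋ k ∷ []) ⟩
  2 * (2 + k)                 ≡⟨ cong (2 *_) (sym ([n+1]Cn≡n+1 (1 + k))) ⟩
  2 * ((2 + k) C (1 + k))     ∎)
  where open ≡-Reasoning
binomial-lower-bound k (suc t) = begin
  (2 + k) * (2 + (1 + k) * suc t)
    ≡⟨ solve (List ℕ ∋ k ∷ t ∷ []) ⟩
  (2 + k) * (2 + (1 + k) * t) + (2 + k) * (1 + k)
    ≡⟨ cong ((2 + k) * (2 + (1 + k) * t) +_) (sym (2*[n+2]Cn≡[n+2]*[n+1] k)) ⟩
  (2 + k) * (2 + (1 + k) * t) + 2 * ((2 + k) C k)
    ≤⟨ +-mono-≤ (binomial-lower-bound k t) (*-monoʳ-≤ 2 (C-monoˡ-≤ k (m≤n+m (2 + k) t))) ⟩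
  2 * ((t + (2 + k)) C (1 + k)) + 2 * ((t + (2 + k)) C k)
    ≡⟨ sym (*-distribˡ-+ 2 ((t + (2 + k)) C (1 + k)) _) ⟩
  2 * ((t + (2 + k)) C (1 + k) + (t + (2 + k)) C k)
    ≡⟨ cong (2 *_) (sym ([n+1]C[k+1] (t + (2 + k)) k)) ⟩
  2 * ((suc t + (2 + k)) C (1 + k)) ∎
  where open ≤-Reasoning

binomial-budget : ∀ k m → (2 + k) * (2 * ind (2 + k ≤ᵇ m) + (1 + k) * (m ∸ (2 + k))) ≤ 2 * (m C (1 + k))
binomial-budget k m with 2 + k ≤ᵇ m in r≤ᵇm
... | true  = subst (λ m′ → (2 + k) * (2 + (1 + k) * (m ∸ (2 + k))) ≤ 2 * (m′ C (1 + k)))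
                    (m∸n+n≡m r≤m) (binomial-lower-bound k (m ∸ (2 + k)))
  where
  r≤m : 2 + k ≤ m
  r≤m = ≤ᵇ⇒≤ (2 + k) m (subst T (sym r≤ᵇm) _)
... | false = ≤-trans (≤-reflexive no-window) z≤n
  where
  m≤r : m ≤ 2 + k
  m≤r = <⇒≤ (≰⇒> λ r≤m → subst T r≤ᵇm (≤⇒≤ᵇ r≤m))
  no-window : (2 + k) * ((1 + k) * (m ∸ (2 + k))) ≡ 0
  no-window = begin
    (2 + k) * ((1 + k) * (m ∸ (2 + k))) ≡⟨ cong (λ d → (2 + k) * ((1 + k) * d)) (m≤n⇒m∸n≡0 m≤r) ⟩
    (2 + k) * ((1 + k) * 0)             ≡⟨ solve (List ℕ ∋ k ∷ []) ⟩
    0                                   ∎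
    where open ≡-Reasoning

count-applyUpTo≤ : ∀ (p : A → Bool) (f : ℕ → A) c k → (∀ i → c ≤ i → p (f i) ≡ false) →
                   count p (applyUpTo f k) ≤ c
count-applyUpTo≤ p f c       zero    _    = z≤n
count-applyUpTo≤ p f zero    (suc k) late rewrite late 0 z≤n =
  count-applyUpTo≤ p (f ∘ suc) zero k (λ i _ → late (suc i) z≤n)
count-applyUpTo≤ p f (suc c) (suc k) late =
  +-mono-≤ (ind≤1 (p (f 0))) (count-applyUpTo≤ p (f ∘ suc) c k (λ i c≤i → late (suc i) (s≤s c≤i)))

count-fitting-indices≤ : ∀ r m → count (λ i → i + r ≤ᵇ m) (applyUpTo suc m) ≤ m ∸ r
count-fitting-indices≤ r m = count-applyUpTo≤ _ suc (m ∸ r) m λ i m∸r≤i →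
  dec-false (suc i + r ≤? m) (λ fits → <⇒≱ (m+n≤o⇒m≤o∸n (suc i) fits) m∸r≤i)

parity-weight≤ : ∀ {c} → 2 ≤ c → ∀ a p → 2 * ind (a ∧ (p ≡ᵇ 0)) + c * ind (a ∧ (p ≡ᵇ 1)) ≤ c * ind a
parity-weight≤ {c} _   false p             rewrite *-zeroʳ c = z≤n
parity-weight≤ {c} 2≤c true  zero          rewrite *-zeroʳ c | *-identityʳ c = 2≤c
parity-weight≤ {c} _   true  (suc zero)    = ≤-refl
parity-weight≤ {c} _   true  (suc (suc p)) rewrite *-zeroʳ c = z≤n

even-weight : ∀ c b → 2 * ind (b ∧ true) + c * ind (b ∧ false) ≡ 2 * ind b
even-weight c true  = cong (2 +_) (*-zeroʳ c)
even-weight c false = *-zeroʳ c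

windowIndices-budget : ∀ {n r'} → 2 ≤ r' → (H : Subset n) →
  2 * (suc r' * length (windowIndices (suc r') H 0)) + r' * (suc r' * length (windowIndices (suc r') H 1))
    ≤ 2 * (∣ H ∣ C r')
windowIndices-budget {r' = zero}  () H
windowIndices-budget {r' = suc k} 2≤r' H = begin
  2 * (r * length (windowIndices r H 0)) + r' * (r * length (windowIndices r H 1))
    ≡⟨ cong₂ (λ a b → 2 * (r * a) + r' * (r * b)) (length-filterᵇ (fits 0) (upTo (suc m)))
                                                   (length-filterᵇ (fits 1) (upTo (suc m))) ⟩
  2 * (r * count (fits 0) (upTo (suc m))) + r' * (r * count (fits 1) (upTo (suc m)))
    ≡⟨ regroup r r' (count (fits 0) (upTo (suc m))) (count (fits 1) (upTo (suc m))) ⟩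
  r * (2 * count (fits 0) (upTo (suc m)) + r' * count (fits 1) (upTo (suc m)))
    ≡⟨ cong (r *_) (sym (∑-linear (upTo (suc m)) 2 r' (ind ∘ fits 0) (ind ∘ fits 1))) ⟩
  r * (weight 0 + ∑[ i ← applyUpTo suc m ] weight i)
    ≤⟨ *-monoʳ-≤ r (+-mono-≤ (≤-reflexive (even-weight r' (r ≤ᵇ m))) later-weights≤) ⟩
  r * (2 * ind (r ≤ᵇ m) + r' * (m ∸ r))
    ≤⟨ binomial-budget k m ⟩
  2 * (m C r') ∎
  where
  open ≤-Reasoning
  r' r m : ℕ
  r' = suc k
  r = suc r'
  m = ∣ H ∣
  fits : ℕ → ℕ → Bool
  fits j i = (i + r ≤ᵇ m) ∧ (i % 2 ≡ᵇ j)
  weight : ℕ → ℕ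
  weight i = 2 * ind (fits 0 i) + r' * ind (fits 1 i)
  regroup : ∀ x y a b → 2 * (x * a) + y * (x * b) ≡ x * (2 * a + y * b)
  regroup x y a b = solve (List ℕ ∋ x ∷ y ∷ a ∷ b ∷ [])
  later-weights≤ : ∑[ i ← applyUpTo suc m ] weight i ≤ r' * (m ∸ r)
  later-weights≤ = begin
    ∑[ i ← applyUpTo suc m ] weight i
      ≤⟨ ∑-mono (applyUpTo suc m) (λ i → parity-weight≤ 2≤r' (i + r ≤ᵇ m) (i % 2)) ⟩
    ∑[ i ← applyUpTo suc m ] (r' * ind (i + r ≤ᵇ m))
      ≡⟨ ∑-*ˡ (applyUpTo suc m) r' _ ⟩
    r' * count (λ i → i + r ≤ᵇ m) (applyUpTo suc m)
      ≤⟨ *-monoʳ-≤ r' (count-fitting-indices≤ r m) ⟩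
    r' * (m ∸ r) ∎

hyperplanes-share-no-subsets : ∀ {n r'} (M : Matroid n) → IsPaving M (suc r') →
  ∑[ H ← allSubsets n ] (ind (isHyperplane M H) * (∣ H ∣ C r')) ≤ n C r'
hyperplanes-share-no-subsets {n} {r'} M paving = begin
  ∑[ H ← S ] (ind (hyp H) * (∣ H ∣ C r'))
    ≡⟨ ∑-cong S (λ H → cong (ind (hyp H) *_) (sym (count-⊆-ofSize r' H))) ⟩
  ∑[ H ← S ] (ind (hyp H) * count (λ Y → c Y ∧ ⌊ Y ⊆? H ⌋) S)
    ≡⟨ ∑-cong S (λ H → sym (∑-*ˡ S (ind (hyp H)) _)) ⟩
  ∑[ H ← S ] ∑[ Y ← S ] (ind (hyp H) * ind (c Y ∧ ⌊ Y ⊆? H ⌋))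
    ≡⟨ ∑-comm S S _ ⟩
  ∑[ Y ← S ] ∑[ H ← S ] (ind (hyp H) * ind (c Y ∧ ⌊ Y ⊆? H ⌋))
    ≤⟨ ∑-mono S containing-hyperplanes≤1 ⟩
  count c S
    ≡⟨ count-ofSize n r' ⟩
  n C r' ∎
  where
  open ≤-Reasoning
  open Matroid M using (Indep)
  S : List (Subset n)
  S = allSubsets n
  hyp : Subset n → Bool
  hyp = isHyperplane M
  c : Subset n → Bool
  c Y = ∣ Y ∣ ≡ᵇ r'
  containing-hyperplanes≤1 : ∀ Y → ∑[ H ← S ] (ind (hyp H) * ind (c Y ∧ ⌊ Y ⊆? H ⌋)) ≤ ind (c Y)
  containing-hyperplanes≤1 Y with c Y in ∣Y∣≡ᵇr'
  ... | false = ≤-reflexive (∑-zero S (λ H → *-zeroʳ (ind (hyp H))))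
  ... | true  = begin
    ∑[ H ← S ] (ind (hyp H) * ind ⌊ Y ⊆? H ⌋) ≡⟨ ∑-cong S (λ H → sym (ind-∧ (hyp H) _)) ⟩
    count (λ H → hyp H ∧ ⌊ Y ⊆? H ⌋) S       ≤⟨ count-allSubsets≤1 _ unique ⟩
    1                                         ∎
    where
    ∣Y∣≡r' : ∣ Y ∣ ≡ r'
    ∣Y∣≡r' = ≡ᵇ⇒≡ ∣ Y ∣ r' (subst T (sym ∣Y∣≡ᵇr') _)
    indepY : Indep Y
    indepY = proj₂ paving Y (subst (_< suc r') (sym ∣Y∣≡r') ≤-refl)
    unique : ∀ {H H'} → T (hyp H ∧ ⌊ Y ⊆? H ⌋) → T (hyp H' ∧ ⌊ Y ⊆? H' ⌋) → H ≡ H'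
    unique {H} {H'} containsY containsY' =
      let hypH  , Y⊆H  = Equivalence.to (T-∧ {hyp H}) containsY
          hypH' , Y⊆H' = Equivalence.to (T-∧ {hyp H'}) containsY'
      in hyperplane-unique M (proj₁ paving) indepY (cong suc ∣Y∣≡r') hypH hypH'
                           (toWitness Y⊆H) (toWitness Y⊆H')

lemma13 : (n r : ℕ) → 3 ≤ r → r ≤ n → (M : Matroid n) → IsPaving M r →
    2 * shadowSize M r 0 + (r ∸ 1) * shadowSize M r 1 ≤ 2 * (n C (r ∸ 1))
lemma13 n (suc r') (s≤s 2≤r') _ M paving = begin
  2 * shadowSize M (suc r') 0 + r' * shadowSize M (suc r') 1
    ≤⟨ +-mono-≤ (*-monoʳ-≤ 2 (shadowSize≤ M r' 0)) (*-monoʳ-≤ r' (shadowSize≤ M r' 1)) ⟩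
  2 * ∑[ H ← S ] (ind (hyp H) * windows H 0) + r' * ∑[ H ← S ] (ind (hyp H) * windows H 1)
    ≡⟨ sym (∑-linear S 2 r' _ _) ⟩
  ∑[ H ← S ] (2 * (ind (hyp H) * windows H 0) + r' * (ind (hyp H) * windows H 1))
    ≤⟨ ∑-mono S (λ H → scaled (ind (hyp H)) (windowIndices-budget 2≤r' H)) ⟩
  ∑[ H ← S ] (2 * (ind (hyp H) * (∣ H ∣ C r')))
    ≡⟨ ∑-*ˡ S 2 _ ⟩
  2 * ∑[ H ← S ] (ind (hyp H) * (∣ H ∣ C r'))
    ≤⟨ *-monoʳ-≤ 2 (hyperplanes-share-no-subsets M paving) ⟩
  2 * (n C r') ∎
  where
  open ≤-Reasoning
  S : List (Subset n)
  S = allSubsets n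
  hyp : Subset n → Bool
  hyp = isHyperplane M
  windows : Subset n → ℕ → ℕ
  windows H j = suc r' * length (windowIndices (suc r') H j)
  scaled : ∀ h {x y z} → 2 * x + r' * y ≤ 2 * z → 2 * (h * x) + r' * (h * y) ≤ 2 * (h * z)
  scaled h {x} {y} {z} budget = begin
    2 * (h * x) + r' * (h * y) ≡⟨ solve (List ℕ ∋ h ∷ x ∷ y ∷ r' ∷ []) ⟩
    h * (2 * x + r' * y)       ≤⟨ *-monoʳ-≤ h budget ⟩
    h * (2 * z)                ≡⟨ solve (List ℕ ∋ h ∷ z ∷ []) ⟩
    2 * (h * z)                ∎
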